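{- Every even-zebra $\Delta$-matroid is coverable.
   Context: For $\alpha\in\{0,1\}^V$, $\alpha\oplus v$ flips coordinate $v$. A nonempty $M\subseteq\{0,1\}^V$ is a $\Delta$-matroid if for all $\alpha,\beta\in M$ and $v$ with $\alpha(v)\ne\beta(v)$ there is $u$ with $\alpha(u)\ne\beta(u)$ and $\alpha\oplus v\oplus u\in M$ (meaning $\alpha\oplus v\in M$ if $u=v$); it is even if all tuples of $M$ have the same parity of number of ones. A $\Delta$-matroid $M$ is an even-zebra if for every $\alpha\in M$ there exists an even $\Delta$-matroid $M_\alpha\subseteq\{0,1\}^V$ containing all tuples of $M$ of the same parity as $\alpha$ and such that for every $\beta\in M$ and every $u,v\in V$ with $\beta\oplus u\oplus v\in M_\alpha\setminus M$ we have $\beta\oplus u\in M$ and $\beta\oplus v\in M$. For $M$ a $\Delta$-matroid: $\alpha,\beta\in M$ are even-neighbors if there are distinct $u,v$ with $\beta=\alpha\oplus u\oplus v$ and $\alpha\oplus u\notin M$; $\gamma\in M$ is reachable from $\alpha\in M$ if there is a chain $\alpha=\beta_0,\dots,\beta_n=\gamma$ in $M$ of consecutive even-neighbors. $M$ is coverable if for every $\alpha\in M$ there is $M_\alpha$ with: (a) $M_\alpha$ an even $\Delta$-matroid on the same ground set; (b) $M_\alpha$ contains all $\beta\in M$ reachable from $\alpha$; (c) whenever $\gamma\in M$ is reachable from $\alpha$ and $\gamma\oplus u\oplus v\in M_\alpha\setminus M$, then $\gamma\oplus u,\gamma\oplus v\in M$. -}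

module Defs where

open import Level using (0ℓ)
open import Function using (id)
open import Data.Nat using (ℕ; _%_)
open import Data.Bool using (Bool; not)
open import Data.Fin using (Fin; _≟_)
open import Data.Vec using (Vec; lookup; updateAt; countᵇ)
open import Data.List using (List)
open import Data.List.Membership.Propositional using (_∈_; _∉_)
open import Data.Product using (Σ; ∃; _×_; ∃-syntax)
open import Relation.Nullary using (¬_; yes; no)
open import Relation.Binary.PropositionalEquality using (_≡_; _≢_)

-- Ground set V = Fin n (finite). A tuple α ∈ {0,1}^V is a Vec Bool n
-- (true = 1). A set of tuples is a (finite) list of tuples, membership _∈_.
Tuple : ℕ → Set
Tuple n = Vec Bool n

TupleSet : ℕ → Set
TupleSet n = List (Tuple n)

_⊕_ : ∀ {n} → Tuple n → Fin n → Tuple n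
α ⊕ v = updateAt α v not

infixl 6 _⊕_

-- α ⊕ v ⊕ u in the Δ-matroid axiom, meaning α ⊕ v when u = v
flipStep : ∀ {n} → Tuple n → Fin n → Fin n → Tuple n
flipStep α v u with u ≟ v
... | yes _ = α ⊕ v
... | no  _ = α ⊕ v ⊕ u

ones : ∀ {n} → Tuple n → ℕ
ones α = countᵇ id α

parity : ∀ {n} → Tuple n → ℕ
parity α = ones α % 2

Nonempty : ∀ {n} → TupleSet n → Set
Nonempty {n} M = ∃[ α ] (α ∈ M)

IsDeltaMatroid : ∀ {n} → TupleSet n → Set
IsDeltaMatroid {n} M =
  Nonempty M ×
  (∀ (α β : Tuple n) → α ∈ M → β ∈ M → (v : Fin n) → lookup α v ≢ lookup β v →
     ∃[ u ] (lookup α u ≢ lookup β u × flipStep α v u ∈ M))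

IsEven : ∀ {n} → TupleSet n → Set
IsEven {n} M = ∀ (α β : Tuple n) → α ∈ M → β ∈ M → parity α ≡ parity β

IsEvenDeltaMatroid : ∀ {n} → TupleSet n → Set
IsEvenDeltaMatroid M = IsDeltaMatroid M × IsEven M

IsEvenZebra : ∀ {n} → TupleSet n → Set
IsEvenZebra {n} M =
  IsDeltaMatroid M ×
  (∀ (α : Tuple n) → α ∈ M →
     ∃[ Mα ] (IsEvenDeltaMatroid Mα
       × (∀ (β : Tuple n) → β ∈ M → parity β ≡ parity α → β ∈ Mα)
       × (∀ (β : Tuple n) → β ∈ M → (u v : Fin n) →
            β ⊕ u ⊕ v ∈ Mα → β ⊕ u ⊕ v ∉ M → (β ⊕ u ∈ M × β ⊕ v ∈ M))))

EvenNeighbors : ∀ {n} → TupleSet n → Tuple n → Tuple n → Set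
EvenNeighbors {n} M α β =
  α ∈ M × β ∈ M × ∃[ u ] ∃[ v ] (u ≢ v × β ≡ α ⊕ u ⊕ v × α ⊕ u ∉ M)

data Reachable {n} (M : TupleSet n) (α : Tuple n) : Tuple n → Set where
  here : α ∈ M → Reachable M α α
  step : ∀ {β γ} → Reachable M α β → EvenNeighbors M β γ → Reachable M α γ

IsCoverable : ∀ {n} → TupleSet n → Set
IsCoverable {n} M =
  IsDeltaMatroid M ×
  (∀ (α : Tuple n) → α ∈ M →
     ∃[ Mα ] (IsEvenDeltaMatroid Mα
       × (∀ (β : Tuple n) → Reachable M α β → β ∈ Mα)
       × (∀ (γ : Tuple n) → Reachable M α γ → (u v : Fin n) →
            γ ⊕ u ⊕ v ∈ Mα → γ ⊕ u ⊕ v ∉ M → (γ ⊕ u ∈ M × γ ⊕ v ∈ M))))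

-- Two even-neighbours differ in exactly two coordinates, so they have the same
-- parity of ones; hence every tuple reachable from α lies in M and has the
-- parity of α. The even Δ-matroid Mα witnessing that M is an even-zebra at α
-- therefore contains everything reachable from α, and its closure condition,
-- which holds for all β ∈ M, holds in particular for the reachable ones.
module Submission where

open import Defs
open import Data.Nat using (ℕ; suc; _%_)
open import Data.Nat.Properties using (+-comm)
open import Data.Nat.DivMod using ([m+n]%n≡m%n)
open import Data.Bool using (true; false)
open import Data.Fin using (Fin; zero; suc)
open import Data.Vec using (_∷_)
open import Data.List.Membership.Propositional using (_∈_)
open import Data.Sum using (_⊎_; inj₁; inj₂)
open import Data.Product using (_,_)
open import Function using (case_of_)
open import Relation.Binary.PropositionalEquality using (_≡_; refl; sym; trans; cong)

ones-⊕ : ∀ {n} (α : Tuple n) (u : Fin n) →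
         ones (α ⊕ u) ≡ suc (ones α) ⊎ suc (ones (α ⊕ u)) ≡ ones α
ones-⊕ (false ∷ α) zero    = inj₁ refl
ones-⊕ (true  ∷ α) zero    = inj₂ refl
ones-⊕ (false ∷ α) (suc u) = ones-⊕ α u
ones-⊕ (true  ∷ α) (suc u) with ones-⊕ α u
... | inj₁ e = inj₁ (cong suc e)
... | inj₂ e = inj₂ (cong suc e)

[2+m]%2≡m%2 : ∀ m → suc (suc m) % 2 ≡ m % 2
[2+m]%2≡m%2 m = trans (cong (_% 2) (+-comm 2 m)) ([m+n]%n≡m%n m 2)

%2-stable-±1±1 : ∀ {a b c} → b ≡ suc a ⊎ suc b ≡ a → c ≡ suc b ⊎ suc c ≡ b →
                 c % 2 ≡ a % 2
%2-stable-±1±1 {a}     (inj₁ refl) (inj₁ refl) = [2+m]%2≡m%2 a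
%2-stable-±1±1         (inj₁ refl) (inj₂ refl) = refl
%2-stable-±1±1         (inj₂ refl) (inj₁ refl) = refl
%2-stable-±1±1 {c = c} (inj₂ refl) (inj₂ refl) = sym ([2+m]%2≡m%2 c)

parity-⊕-⊕ : ∀ {n} (α : Tuple n) (u v : Fin n) → parity (α ⊕ u ⊕ v) ≡ parity α
parity-⊕-⊕ α u v = %2-stable-±1±1 (ones-⊕ α u) (ones-⊕ (α ⊕ u) v)

module _ {n} {M : TupleSet n} {α : Tuple n} where

  reachable⇒∈ : ∀ {γ} → Reachable M α γ → γ ∈ M
  reachable⇒∈ (here α∈M)            = α∈M
  reachable⇒∈ (step _ (_ , γ∈M , _)) = γ∈M

  reachable⇒parity≡ : ∀ {γ} → Reachable M α γ → parity γ ≡ parity α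
  reachable⇒parity≡ (here _) = refl
  reachable⇒parity≡ (step {β} r (_ , _ , u , v , _ , refl , _)) =
    trans (parity-⊕-⊕ β u v) (reachable⇒parity≡ r)

mainTheorem16 : ∀ (n : ℕ) (M : TupleSet n) → IsEvenZebra M → IsCoverable M
mainTheorem16 n M (isΔ , zebra) = isΔ , λ α α∈M → case zebra α α∈M of λ where
  (Mα , isEvenΔ , ⊇sameParity , closed) →
    Mα , isEvenΔ
       , (λ β r → ⊇sameParity β (reachable⇒∈ r) (reachable⇒parity≡ r))
       , (λ γ r → closed γ (reachable⇒∈ r))
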